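{- Let $\Delta=({\mathcal V},{\mathcal D})$ be a digraph without sources and sinks admitting a dart-transitive group of symmetries $G$, and let $\Gamma=\mathrm{SBP}(\Delta,\Delta)$. Let $G\times G$ act on the vertices of $\Gamma$ by $(a,x,i)^{(g_1,g_2)}=(a^{g_1},x^{g_2},i)$, and let $\tau$ be the permutation $(a,x,i)^\tau=(x,a,1-i)$. Then $\langle G\times G,\tau\rangle$ acts transitively on the darts of $\Gamma$ and is isomorphic to the wreath product $G\wr C_2\cong(G\times G)\rtimes C_2$. Moreover, if $\Delta$ is reversible with a reversal $\tilde\sigma$ and $\sigma$ is the reversal of $\Gamma$ given by $(a,x,i)^\sigma=(a^{\tilde\sigma},x^{\tilde\sigma},1-i)$, then the group $\langle G\times G,\tau,\sigma\rangle$ acts dart-transitively on the underlying graph of $\Gamma$.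
   Context: A digraph is a pair $({\mathcal V},{\mathcal D})$ with ${\mathcal V}$ a finite non-empty set and ${\mathcal D}$ a set of ordered pairs of distinct vertices (darts). A source (sink) is a vertex of in-valence (out-valence) $0$. A symmetry is a vertex permutation preserving the darts; a group of symmetries is dart-transitive if transitive on darts. The reverse of $\Delta$ is $({\mathcal V},{\mathcal D}^{ -1})$ with ${\mathcal D}^{ -1}=\{(v,u):(u,v)\in{\mathcal D}\}$; a reversal is an isomorphism from a digraph to its reverse, and a digraph is reversible if it has one. The underlying graph of a digraph is $({\mathcal V},{\mathcal D}\cup{\mathcal D}^{ -1})$. $\mathrm{SBP}(\Gamma_1,\Gamma_2)$ for $\Gamma_j=({\mathcal V}_j,{\mathcal D}_j)$ has vertex set ${\mathcal V}_1\times{\mathcal V}_2\times\mathbb Z_2$ and darts all $((a,x,0),(b,x,1))$ with $(a,b)\in{\mathcal D}_1$, $x\in{\mathcal V}_2$, and all $((a,x,1),(a,y,0))$ with $a\in{\mathcal V}_1$, $(x,y)\in{\mathcal D}_2$. -}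

module Defs where

open import Level using (0ℓ)
open import Data.Nat using (ℕ; NonZero)
open import Data.Fin using (Fin)
open import Data.Bool using (Bool; true; false; not; _xor_; _∧_; _∨_; if_then_else_)
open import Data.Bool.Properties using (not-involutive)
open import Data.Product using (Σ; ∃; _×_; _,_; proj₁; proj₂)
open import Data.Sum using (_⊎_)
open import Function using (_∘_)
open import Function.Bundles using (_↔_; Inverse; mk↔ₛ′)
open import Function.Construct.Identity using (↔-id)
open import Function.Construct.Symmetry using (↔-sym)
open import Relation.Nullary using (¬_)
open import Relation.Nullary.Decidable using (⌊_⌋)
open import Relation.Binary.Definitions using (DecidableEquality)
open import Relation.Binary.PropositionalEquality using (_≡_; refl; cong₂)
open import Algebra.Bundles.Raw using (RawGroup)

record Digraph (V : Set) : Set where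
  field
    adj    : V → V → Bool
    irrefl : ∀ v → adj v v ≡ false
open Digraph public

IsDart : ∀ {V} → Digraph V → V → V → Set
IsDart Δ u v = adj Δ u v ≡ true

IsSource : ∀ {V} → Digraph V → V → Set
IsSource Δ v = ∀ u → adj Δ u v ≡ false

IsSink : ∀ {V} → Digraph V → V → Set
IsSink Δ v = ∀ u → adj Δ v u ≡ false

NoSourcesNoSinks : ∀ {V} → Digraph V → Set
NoSourcesNoSinks Δ = ∀ v → ¬ IsSource Δ v × ¬ IsSink Δ v

-- Permutations of a vertex type, acting on the right:
--   v ^ p = p ⟨ v ⟩ ,   v ^ (p · q) = (v ^ p) ^ q .

Perm : Set → Set
Perm V = V ↔ V

_⟨_⟩ : ∀ {V} → Perm V → V → V
p ⟨ v ⟩ = Inverse.to p v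

_≈ₚ_ : ∀ {V} → Perm V → Perm V → Set
p ≈ₚ q = ∀ v → p ⟨ v ⟩ ≡ q ⟨ v ⟩

_·_ : ∀ {V} → Perm V → Perm V → Perm V
p · q = mk↔ₛ′ (Inverse.to q ∘ Inverse.to p) (Inverse.from p ∘ Inverse.from q) l r
  where
  open Relation.Binary.PropositionalEquality
  l : ∀ y → Inverse.to q (Inverse.to p (Inverse.from p (Inverse.from q y))) ≡ y
  l y = trans (cong (Inverse.to q) (Inverse.strictlyInverseˡ p _)) (Inverse.strictlyInverseˡ q y)
  r : ∀ x → Inverse.from p (Inverse.from q (Inverse.to q (Inverse.to p x))) ≡ x
  r x = trans (cong (Inverse.from p) (Inverse.strictlyInverseʳ q _)) (Inverse.strictlyInverseʳ p x)

idₚ : ∀ {V} → Perm V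
idₚ = ↔-id _

_⁻¹ₚ : ∀ {V} → Perm V → Perm V
p ⁻¹ₚ = ↔-sym p

IsSymmetry : ∀ {V} → Digraph V → Perm V → Set
IsSymmetry Δ p = ∀ u v → adj Δ (p ⟨ u ⟩) (p ⟨ v ⟩) ≡ adj Δ u v

IsReversal : ∀ {V} → Digraph V → Perm V → Set
IsReversal Δ p = ∀ u v → adj Δ (p ⟨ v ⟩) (p ⟨ u ⟩) ≡ adj Δ u v

record PermGroup (V : Set) : Set₁ where
  field
    _∈G_  : Perm V → Set
    resp  : ∀ {p q} → p ≈ₚ q → _∈G_ p → _∈G_ q
    id∈   : _∈G_ idₚ
    ·∈    : ∀ {p q} → _∈G_ p → _∈G_ q → _∈G_ (p · q)
    ⁻¹∈   : ∀ {p} → _∈G_ p → _∈G_ (p ⁻¹ₚ)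
open PermGroup public

record SymmetryGroup {V : Set} (Δ : Digraph V) : Set₁ where
  field
    group     : PermGroup V
    symmetric : ∀ {p} → _∈G_ group p → IsSymmetry Δ p
open SymmetryGroup public

DartTransitive : ∀ {V} → Digraph V → (Perm V → Set) → Set
DartTransitive Δ P = ∀ u v u′ v′ → IsDart Δ u v → IsDart Δ u′ v′ →
  Σ (Perm _) λ g → P g × (g ⟨ u ⟩ ≡ u′) × (g ⟨ v ⟩ ≡ v′)

data Gen {V : Set} (S : Perm V → Set) : Perm V → Set where
  gen  : ∀ {p} → S p → Gen S p
  idg  : Gen S idₚ
  mulg : ∀ {p q} → Gen S p → Gen S q → Gen S (p · q)
  invg : ∀ {p} → Gen S p → Gen S (p ⁻¹ₚ)
  resg : ∀ {p q} → p ≈ₚ q → Gen S p → Gen S q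

PermRawGroup : ∀ {V} (P : Perm V → Set) →
  (∀ {p q} → P p → P q → P (p · q)) → P idₚ → (∀ {p} → P p → P (p ⁻¹ₚ)) →
  RawGroup 0ℓ 0ℓ
PermRawGroup {V} P m e i = record
  { Carrier = Σ (Perm V) P
  ; _≈_     = λ x y → proj₁ x ≈ₚ proj₁ y
  ; _∙_     = λ x y → (proj₁ x · proj₁ y) , m (proj₂ x) (proj₂ y)
  ; ε       = idₚ , e
  ; _⁻¹     = λ x → (proj₁ x ⁻¹ₚ) , i (proj₂ x)
  }

GenRawGroup : ∀ {V} (S : Perm V → Set) → RawGroup 0ℓ 0ℓ
GenRawGroup S = PermRawGroup (Gen S) mulg idg invg

-- Wreath product  G ≀ C₂ ≅ (G × G) ⋊ C₂ , C₂ = Bool (under xor) acting on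
-- G × G by swapping the coordinates.

swapIf : ∀ {A : Set} → Bool → A × A → A × A
swapIf false (x , y) = x , y
swapIf true  (x , y) = y , x

WreathC2 : ∀ {V} → PermGroup V → RawGroup 0ℓ 0ℓ
WreathC2 {V} G = record
  { Carrier = El × El × Bool
  ; _≈_     = λ { (g₁ , g₂ , b) (h₁ , h₂ , c) →
                  (proj₁ g₁ ≈ₚ proj₁ h₁) × (proj₁ g₂ ≈ₚ proj₁ h₂) × (b ≡ c) }
  ; _∙_     = λ { (g₁ , g₂ , b) (h₁ , h₂ , c) →
                  let (h₁′ , h₂′) = swapIf b (h₁ , h₂) in
                  mulE g₁ h₁′ , mulE g₂ h₂′ , b xor c }
  ; ε       = (idₚ , id∈ G) , (idₚ , id∈ G) , false
  ; _⁻¹     = λ { (g₁ , g₂ , b) →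
                  let (k₁ , k₂) = swapIf b (invE g₁ , invE g₂) in k₁ , k₂ , b }
  }
  where
  El : Set
  El = Σ (Perm V) (_∈G_ G)
  mulE : El → El → El
  mulE (p , x) (q , y) = (p · q) , ·∈ G x y
  invE : El → El
  invE (p , x) = (p ⁻¹ₚ) , ⁻¹∈ G x

-- The split bipartite product  SBP(Γ₁, Γ₂);  ℤ₂ = Bool with false = 0, true = 1.

module _ {V₁ V₂ : Set} (_≟₁_ : DecidableEquality V₁) (_≟₂_ : DecidableEquality V₂) where
  sbpAdj : Digraph V₁ → Digraph V₂ → V₁ × V₂ × Bool → V₁ × V₂ × Bool → Bool
  sbpAdj Γ₁ Γ₂ (a , x , false) (b , y , true)  = adj Γ₁ a b ∧ ⌊ x ≟₂ y ⌋
  sbpAdj Γ₁ Γ₂ (a , x , true)  (b , y , false) = ⌊ a ≟₁ b ⌋ ∧ adj Γ₂ x y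
  sbpAdj Γ₁ Γ₂ (a , x , false) (b , y , false) = false
  sbpAdj Γ₁ Γ₂ (a , x , true)  (b , y , true)  = false

  sbpIrrefl : ∀ Γ₁ Γ₂ v → sbpAdj Γ₁ Γ₂ v v ≡ false
  sbpIrrefl Γ₁ Γ₂ (a , x , false) = refl
  sbpIrrefl Γ₁ Γ₂ (a , x , true)  = refl

  SBP : Digraph V₁ → Digraph V₂ → Digraph (V₁ × V₂ × Bool)
  SBP Γ₁ Γ₂ = record { adj = sbpAdj Γ₁ Γ₂ ; irrefl = sbpIrrefl Γ₁ Γ₂ }

Underlying : ∀ {V} → Digraph V → Digraph V
Underlying Δ = record
  { adj    = λ u v → adj Δ u v ∨ adj Δ v u
  ; irrefl = λ v → Relation.Binary.PropositionalEquality.cong (λ b → b ∨ b) (irrefl Δ v) }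

pairPerm : ∀ {V} → Perm V → Perm V → Perm (V × V × Bool)
pairPerm g₁ g₂ = mk↔ₛ′ (λ { (a , x , i) → g₁ ⟨ a ⟩ , g₂ ⟨ x ⟩ , i })
                      (λ { (a , x , i) → Inverse.from g₁ a , Inverse.from g₂ x , i })
                      (λ { (a , x , i) → cong₂ _,_ (Inverse.strictlyInverseˡ g₁ a)
                                           (cong₂ _,_ (Inverse.strictlyInverseˡ g₂ x) refl) })
                      (λ { (a , x , i) → cong₂ _,_ (Inverse.strictlyInverseʳ g₁ a)
                                           (cong₂ _,_ (Inverse.strictlyInverseʳ g₂ x) refl) })

τ : ∀ {V} → Perm (V × V × Bool)
τ = mk↔ₛ′ f f inv inv
  where
  f : _ → _
  f (a , x , i) = x , a , not i
  inv : ∀ v → f (f v) ≡ v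
  inv (a , x , i) = cong₂ _,_ refl (cong₂ _,_ refl (not-involutive i))

σOf : ∀ {V} → Perm V → Perm (V × V × Bool)
σOf s = pairPerm s s · τ′
  where
  τ′ : Perm _
  τ′ = mk↔ₛ′ f f inv inv
    where
    f : _ → _
    f (a , x , i) = a , x , not i
    inv : ∀ v → f (f v) ≡ v
    inv (a , x , i) = cong₂ _,_ refl (cong₂ _,_ refl (not-involutive i))

GG : ∀ {V} → PermGroup V → Perm (V × V × Bool) → Set
GG G p = Σ (Perm _) λ g₁ → Σ (Perm _) λ g₂ →
           _∈G_ G g₁ × _∈G_ G g₂ × (p ≈ₚ pairPerm g₁ g₂)

GGτ : ∀ {V} → PermGroup V → Perm (V × V × Bool) → Set
GGτ G p = GG G p ⊎ (p ≈ₚ τ)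

GGτσ : ∀ {V} → PermGroup V → Perm V → Perm (V × V × Bool) → Set
GGτσ G s p = GG G p ⊎ (p ≈ₚ τ) ⊎ (p ≈ₚ σOf s)

-- A dart of SBP(Δ, Δ) lies either in the first factor, ((a,x,0),(b,x,1)) with (a,b) a dart
-- of Δ, or in the second, ((a,x,1),(a,y,0)) with (x,y) a dart of Δ.  G × G is transitive on
-- the darts of each kind: G is dart-transitive in the coordinate carrying the dart and
-- vertex-transitive (because Δ has no sinks) in the other one; and τ interchanges the two
-- kinds.  Every element of ⟨G × G, τ⟩ acts on V × V × ℤ₂ as an element of G ≀ C₂ does, and
-- this action of G ≀ C₂ is faithful, which yields the isomorphism.  Finally σ is a reversal
-- of SBP(Δ, Δ), so in the underlying graph it carries each dart onto one of the opposite
-- orientation.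
module Submission where

open import Defs
open import Data.Nat using (ℕ; NonZero; suc)
open import Data.Fin using (Fin; _≟_)
import Data.Fin as Fin
open import Data.Fin.Properties using (¬∀⟶∃¬)
open import Data.Bool using (Bool; true; false; not; _∧_; _∨_)
import Data.Bool as Bool
open import Data.Bool.Properties using (∧-comm; ∨-comm; ∧-conicalˡ; ∧-conicalʳ; ¬-not; not-involutive)
open import Data.Product using (Σ; _×_; _,_; proj₁; proj₂)
open import Data.Sum using (_⊎_; inj₁; inj₂; map₂)
open import Function using (_∘_; case_of_)
open import Function.Bundles using (Inverse; _⇔_; mk⇔)
open import Relation.Nullary using (Dec; ¬_; yes; no)
open import Relation.Nullary.Decidable using (⌊_⌋; does-⇔; isYes≗does)
open import Relation.Binary.Definitions using (DecidableEquality)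
open import Relation.Binary.PropositionalEquality
open import Algebra.Morphism.Structures using (module GroupMorphisms)
open import Algebra.Bundles.Raw using (RawGroup)

∨-true : ∀ {x y} → x ∨ y ≡ true → x ≡ true ⊎ y ≡ true
∨-true {true}  _ = inj₁ refl
∨-true {false} e = inj₂ e

⌊⌋-⇔ : ∀ {A B : Set} → A ⇔ B → (a? : Dec A) (b? : Dec B) → ⌊ a? ⌋ ≡ ⌊ b? ⌋
⌊⌋-⇔ A⇔B a? b? = trans (isYes≗does a?) (trans (does-⇔ A⇔B a? b?) (sym (isYes≗does b?)))

⟨⟩-injective : ∀ {V} (p : Perm V) {x y} → p ⟨ x ⟩ ≡ p ⟨ y ⟩ → x ≡ y
⟨⟩-injective p {x} {y} e = begin
  x                        ≡⟨ sym (Inverse.strictlyInverseʳ p x) ⟩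
  Inverse.from p (p ⟨ x ⟩) ≡⟨ cong (Inverse.from p) e ⟩
  Inverse.from p (p ⟨ y ⟩) ≡⟨ Inverse.strictlyInverseʳ p y ⟩
  y                        ∎
  where open ≡-Reasoning

Gen-mono : ∀ {V} {S T : Perm V → Set} → (∀ {p} → S p → T p) → ∀ {p} → Gen S p → Gen T p
Gen-mono f (gen s)    = gen (f s)
Gen-mono f idg        = idg
Gen-mono f (mulg a b) = mulg (Gen-mono f a) (Gen-mono f b)
Gen-mono f (invg a)   = invg (Gen-mono f a)
Gen-mono f (resg e a) = resg e (Gen-mono f a)

module _ {V : Set} (Γ : Digraph V) where

  IsSymmetry-resp : ∀ {p q} → p ≈ₚ q → IsSymmetry Γ q → IsSymmetry Γ p
  IsSymmetry-resp p≈q q-sym u v = trans (cong₂ (adj Γ) (p≈q u) (p≈q v)) (q-sym u v)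

  Gen-isSymmetry : (S : Perm V → Set) → (∀ {p} → S p → IsSymmetry Γ p) →
                   ∀ p → Gen S p → IsSymmetry Γ p
  Gen-isSymmetry S S-sym p (gen s) = S-sym s
  Gen-isSymmetry S S-sym _ idg u v = refl
  Gen-isSymmetry S S-sym _ (mulg {p} {q} gp gq) u v =
    trans (Gen-isSymmetry S S-sym q gq (p ⟨ u ⟩) (p ⟨ v ⟩)) (Gen-isSymmetry S S-sym p gp u v)
  Gen-isSymmetry S S-sym _ (invg {p} gp) u v =
    trans (sym (Gen-isSymmetry S S-sym p gp (Inverse.from p u) (Inverse.from p v)))
          (cong₂ (adj Γ) (Inverse.strictlyInverseˡ p u) (Inverse.strictlyInverseˡ p v))
  Gen-isSymmetry S S-sym _ (resg {p} {q} p≈q gp) =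
    IsSymmetry-resp {q} {p} (sym ∘ p≈q) (Gen-isSymmetry S S-sym p gp)

  symmetry⇒underlyingSymmetry : ∀ {p} → IsSymmetry Γ p → IsSymmetry (Underlying Γ) p
  symmetry⇒underlyingSymmetry p-sym u v = cong₂ _∨_ (p-sym u v) (p-sym v u)

  reversal⇒underlyingSymmetry : ∀ {p} → IsReversal Γ p → IsSymmetry (Underlying Γ) p
  reversal⇒underlyingSymmetry p-rev u v =
    trans (cong₂ _∨_ (p-rev v u) (p-rev u v)) (∨-comm (adj Γ v u) (adj Γ u v))

  -- The reversal r converts between the two orientations of a dart of the underlying graph.
  underlying-dartTransitive : (S : Perm V → Set) → DartTransitive Γ (Gen S) →
    (r : Perm V) → IsReversal Γ r → Gen S r → DartTransitive (Underlying Γ) (Gen S)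
  underlying-dartTransitive S trans-Γ r r-rev r∈ u v u′ v′ d d′
    with ∨-true {adj Γ u v} d | ∨-true {adj Γ u′ v′} d′
  ... | inj₁ uv | inj₁ u′v′ = trans-Γ u v u′ v′ uv u′v′
  ... | inj₂ vu | inj₂ v′u′ with trans-Γ v u v′ u′ vu v′u′
  ...   | g , g∈ , gv , gu = g , g∈ , gu , gv
  underlying-dartTransitive S trans-Γ r r-rev r∈ u v u′ v′ d d′
      | inj₁ uv | inj₂ v′u′ with trans-Γ (r ⟨ v ⟩) (r ⟨ u ⟩) v′ u′ (trans (r-rev u v) uv) v′u′
  ...   | g , g∈ , grv , gru = r · g , mulg r∈ g∈ , gru , grv
  underlying-dartTransitive S trans-Γ r r-rev r∈ u v u′ v′ d d′
      | inj₂ vu | inj₁ u′v′ with trans-Γ v u (r ⟨ v′ ⟩) (r ⟨ u′ ⟩) vu (trans (r-rev u′ v′) u′v′)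
  ...   | g , g∈ , gv , gu =
    g · (r ⁻¹ₚ) , mulg g∈ (invg r∈) ,
    trans (cong (Inverse.from r) gu) (Inverse.strictlyInverseʳ r u′) ,
    trans (cong (Inverse.from r) gv) (Inverse.strictlyInverseʳ r v′)

Moves : ∀ {V} → (Perm V → Set) → V → V → V → V → Set
Moves {V} P u v u′ v′ = Σ (Perm V) λ g → P g × (g ⟨ u ⟩ ≡ u′) × (g ⟨ v ⟩ ≡ v′)

VertexTransitive : ∀ {V} → (Perm V → Set) → Set
VertexTransitive {V} P = ∀ u u′ → Σ (Perm V) λ g → P g × (g ⟨ u ⟩ ≡ u′)

module _ {n : ℕ} (Δ : Digraph (Fin n)) where

  outNeighbour : ∀ v → ¬ IsSink Δ v → Σ (Fin n) λ w → IsDart Δ v w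
  outNeighbour v ¬sink with ¬∀⟶∃¬ n (λ w → adj Δ v w ≡ false) (λ w → adj Δ v w Bool.≟ false) ¬sink
  ... | w , vw≢false = w , ¬-not vw≢false

  dartTransitive⇒vertexTransitive : (∀ v → ¬ IsSink Δ v) →
    ∀ {P} → DartTransitive Δ P → VertexTransitive P
  dartTransitive⇒vertexTransitive noSinks trans-Δ u u′
    with outNeighbour u (noSinks u) | outNeighbour u′ (noSinks u′)
  ... | w , uw | w′ , u′w′ with trans-Δ u w u′ w′ uw u′w′
  ...   | g , g∈ , gu , _ = g , g∈ , gu

-- The split bipartite product

module _ {V : Set} (G : PermGroup V) where

  pairPerm∈Gen : ∀ {g₁ g₂} → _∈G_ G g₁ → _∈G_ G g₂ → Gen (GGτ G) (pairPerm g₁ g₂)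
  pairPerm∈Gen {g₁} {g₂} g₁∈ g₂∈ = gen (inj₁ (g₁ , g₂ , g₁∈ , g₂∈ , λ _ → refl))

  τ∈Gen : Gen (GGτ G) τ
  τ∈Gen = gen (inj₂ λ _ → refl)

module _ {V : Set} (_≟ᵥ_ : DecidableEquality V) where

  private
    V³ : Set
    V³ = V × V × Bool

    SBPᵥ : Digraph V → Digraph V → Digraph V³
    SBPᵥ = SBP _≟ᵥ_ _≟ᵥ_

  ≟-sound : ∀ {x y} → ⌊ x ≟ᵥ y ⌋ ≡ true → x ≡ y
  ≟-sound {x} {y} e with x ≟ᵥ y
  ... | yes x≡y = x≡y
  ≟-sound () | no _

  ⌊≟⌋-⟨⟩ : (p : Perm V) (x y : V) → ⌊ (p ⟨ x ⟩) ≟ᵥ (p ⟨ y ⟩) ⌋ ≡ ⌊ x ≟ᵥ y ⌋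
  ⌊≟⌋-⟨⟩ p x y = ⌊⌋-⇔ (mk⇔ (⟨⟩-injective p) (cong (p ⟨_⟩))) _ _

  ⌊≟⌋-⟨⟩-flip : (p : Perm V) (x y : V) → ⌊ (p ⟨ y ⟩) ≟ᵥ (p ⟨ x ⟩) ⌋ ≡ ⌊ x ≟ᵥ y ⌋
  ⌊≟⌋-⟨⟩-flip p x y = ⌊⌋-⇔ (mk⇔ (sym ∘ ⟨⟩-injective p) (cong (p ⟨_⟩) ∘ sym)) _ _

  pairPerm-isSymmetry : ∀ {Γ₁ Γ₂ g₁ g₂} → IsSymmetry Γ₁ g₁ → IsSymmetry Γ₂ g₂ →
                        IsSymmetry (SBPᵥ Γ₁ Γ₂) (pairPerm g₁ g₂)
  pairPerm-isSymmetry {g₁ = g₁} {g₂} g₁-sym g₂-sym = λ where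
    (a , x , false) (b , y , true)  → cong₂ _∧_ (g₁-sym a b) (⌊≟⌋-⟨⟩ g₂ x y)
    (a , x , true)  (b , y , false) → cong₂ _∧_ (⌊≟⌋-⟨⟩ g₁ a b) (g₂-sym x y)
    (a , x , false) (b , y , false) → refl
    (a , x , true)  (b , y , true)  → refl

  τ-swapsFactors : ∀ Γ₁ Γ₂ u v → adj (SBPᵥ Γ₂ Γ₁) (τ ⟨ u ⟩) (τ ⟨ v ⟩) ≡ adj (SBPᵥ Γ₁ Γ₂) u v
  τ-swapsFactors Γ₁ Γ₂ (a , x , false) (b , y , true)  = ∧-comm ⌊ x ≟ᵥ y ⌋ (adj Γ₁ a b)
  τ-swapsFactors Γ₁ Γ₂ (a , x , true)  (b , y , false) = ∧-comm (adj Γ₂ x y) ⌊ a ≟ᵥ b ⌋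
  τ-swapsFactors Γ₁ Γ₂ (a , x , false) (b , y , false) = refl
  τ-swapsFactors Γ₁ Γ₂ (a , x , true)  (b , y , true)  = refl

  σOf-isReversal : ∀ {Γ₁ Γ₂ s} → IsReversal Γ₁ s → IsReversal Γ₂ s → IsReversal (SBPᵥ Γ₁ Γ₂) (σOf s)
  σOf-isReversal {s = s} s-rev₁ s-rev₂ = λ where
    (a , x , false) (b , y , true)  → cong₂ _∧_ (s-rev₁ a b) (⌊≟⌋-⟨⟩-flip s x y)
    (a , x , true)  (b , y , false) → cong₂ _∧_ (⌊≟⌋-⟨⟩-flip s a b) (s-rev₂ x y)
    (a , x , false) (b , y , false) → refl
    (a , x , true)  (b , y , true)  → refl

  data SBPDart (Γ₁ Γ₂ : Digraph V) : V³ → V³ → Set where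
    firstFactor  : ∀ {a b} x → IsDart Γ₁ a b → SBPDart Γ₁ Γ₂ (a , x , false) (b , x , true)
    secondFactor : ∀ a {x y} → IsDart Γ₂ x y → SBPDart Γ₁ Γ₂ (a , x , true) (a , y , false)

  sbpDart : ∀ {Γ₁ Γ₂} u v → IsDart (SBPᵥ Γ₁ Γ₂) u v → SBPDart Γ₁ Γ₂ u v
  sbpDart {Γ₁} (a , x , false) (b , y , true) d
    with refl ← ≟-sound (∧-conicalʳ (adj Γ₁ a b) _ d) = firstFactor x (∧-conicalˡ _ _ d)
  sbpDart {Γ₁} (a , x , true) (b , y , false) d
    with refl ← ≟-sound (∧-conicalˡ _ _ d) = secondFactor a (∧-conicalʳ ⌊ a ≟ᵥ b ⌋ _ d)

  GGτ-isSymmetry : ∀ {Δ} (G : SymmetryGroup Δ) {p} → GGτ (group G) p → IsSymmetry (SBPᵥ Δ Δ) p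
  GGτ-isSymmetry {Δ} G {p} (inj₁ (g₁ , g₂ , g₁∈ , g₂∈ , p≈g₁g₂)) =
    IsSymmetry-resp (SBPᵥ Δ Δ) {p} {pairPerm g₁ g₂} p≈g₁g₂
      (pairPerm-isSymmetry {Δ} {Δ} {g₁} {g₂} (symmetric G g₁∈) (symmetric G g₂∈))
  GGτ-isSymmetry {Δ} G {p} (inj₂ p≈τ) =
    IsSymmetry-resp (SBPᵥ Δ Δ) {p} {τ} p≈τ (τ-swapsFactors Δ Δ)

  GGτσ-isUnderlyingSymmetry : ∀ {Δ} (G : SymmetryGroup Δ) s → IsReversal Δ s →
    ∀ {p} → GGτσ (group G) s p → IsSymmetry (Underlying (SBPᵥ Δ Δ)) p
  GGτσ-isUnderlyingSymmetry {Δ} G s s-rev {p} (inj₁ p∈GG) =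
    symmetry⇒underlyingSymmetry (SBPᵥ Δ Δ) {p} (GGτ-isSymmetry G {p} (inj₁ p∈GG))
  GGτσ-isUnderlyingSymmetry {Δ} G s s-rev {p} (inj₂ (inj₁ p≈τ)) =
    symmetry⇒underlyingSymmetry (SBPᵥ Δ Δ) {p} (GGτ-isSymmetry G {p} (inj₂ p≈τ))
  GGτσ-isUnderlyingSymmetry {Δ} G s s-rev {p} (inj₂ (inj₂ p≈σ)) =
    IsSymmetry-resp (Underlying (SBPᵥ Δ Δ)) {p} {σOf s} p≈σ
      (reversal⇒underlyingSymmetry (SBPᵥ Δ Δ) {σOf s} (σOf-isReversal {Δ} {Δ} {s} s-rev s-rev))

  module _ (Δ : Digraph V) (G : PermGroup V)
           (Δ-trans : DartTransitive Δ (_∈G_ G)) (V-trans : VertexTransitive (_∈G_ G)) where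

    firstFactor-transitive : ∀ {a b a′ b′} x x′ → IsDart Δ a b → IsDart Δ a′ b′ →
      Moves (Gen (GGτ G)) (a , x , false) (b , x , true) (a′ , x′ , false) (b′ , x′ , true)
    firstFactor-transitive {a} {b} {a′} {b′} x x′ ab a′b′
      with Δ-trans a b a′ b′ ab a′b′ | V-trans x x′
    ... | g₁ , g₁∈ , g₁a , g₁b | g₂ , g₂∈ , g₂x =
      pairPerm g₁ g₂ , pairPerm∈Gen G g₁∈ g₂∈ ,
      cong₂ _,_ g₁a (cong₂ _,_ g₂x refl) , cong₂ _,_ g₁b (cong₂ _,_ g₂x refl)

    -- τ maps a second-factor dart to a first-factor one, which reduces every case to the first.
    SBPDart-transitive : ∀ {u v u′ v′} → SBPDart Δ Δ u v → SBPDart Δ Δ u′ v′ →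
                         Moves (Gen (GGτ G)) u v u′ v′
    SBPDart-transitive (firstFactor x ab) (firstFactor x′ a′b′) =
      firstFactor-transitive x x′ ab a′b′
    SBPDart-transitive (firstFactor x ab) (secondFactor a′ x′y′)
      with firstFactor-transitive x a′ ab x′y′
    ... | g , g∈ , gu , gv = g · τ , mulg g∈ (τ∈Gen G) , cong (τ ⟨_⟩) gu , cong (τ ⟨_⟩) gv
    SBPDart-transitive (secondFactor a xy) (firstFactor x′ a′b′)
      with firstFactor-transitive a x′ xy a′b′
    ... | g , g∈ , gu , gv = τ · g , mulg (τ∈Gen G) g∈ , gu , gv
    SBPDart-transitive (secondFactor a xy) (secondFactor a′ x′y′)
      with firstFactor-transitive a a′ xy x′y′
    ... | g , g∈ , gu , gv =
      (τ · g) · τ , mulg (mulg (τ∈Gen G) g∈) (τ∈Gen G) , cong (τ ⟨_⟩) gu , cong (τ ⟨_⟩) gv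

    SBP-dartTransitive : DartTransitive (SBPᵥ Δ Δ) (Gen (GGτ G))
    SBP-dartTransitive u v u′ v′ d d′ = SBPDart-transitive (sbpDart u v d) (sbpDart u′ v′ d′)

    SBP-underlying-dartTransitive : ∀ s → IsReversal Δ s →
      DartTransitive (Underlying (SBPᵥ Δ Δ)) (Gen (GGτσ G s))
    SBP-underlying-dartTransitive s s-rev =
      underlying-dartTransitive (SBPᵥ Δ Δ) (GGτσ G s)
        (λ u v u′ v′ d d′ → case SBP-dartTransitive u v u′ v′ d d′ of λ where
          (g , g∈ , gu , gv) → g , Gen-mono (map₂ inj₁) g∈ , gu , gv)
        (σOf s) (σOf-isReversal {Δ} {Δ} {s} s-rev s-rev) (gen (inj₂ (inj₂ λ _ → refl)))

-- ⟨G × G, τ⟩ as the wreath product G ≀ C₂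

module _ {V : Set} (G : PermGroup V) where

  private
    V³ : Set
    V³ = V × V × Bool

    W : Set
    W = RawGroup.Carrier (WreathC2 G)

  open RawGroup (WreathC2 G) using () renaming (_≈_ to _≈ʷ_; _∙_ to _∙ʷ_; _⁻¹ to _⁻¹ʷ; ε to εʷ)

  wreathAct : W → V³ → V³
  wreathAct ((g₁ , _) , (g₂ , _) , false) (a , x , i) = g₁ ⟨ a ⟩ , g₂ ⟨ x ⟩ , i
  wreathAct ((g₁ , _) , (g₂ , _) , true)  (a , x , i) = g₂ ⟨ x ⟩ , g₁ ⟨ a ⟩ , not i

  wreathAct-∙ : ∀ w w′ v → wreathAct w′ (wreathAct w v) ≡ wreathAct (w ∙ʷ w′) v
  wreathAct-∙ (_ , _ , false) (_ , _ , false) _ = refl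
  wreathAct-∙ (_ , _ , false) (_ , _ , true)  _ = refl
  wreathAct-∙ (_ , _ , true)  (_ , _ , false) _ = refl
  wreathAct-∙ (_ , _ , true)  (_ , _ , true)  (a , x , i) =
    cong₂ _,_ refl (cong₂ _,_ refl (not-involutive i))

  wreathAct-⁻¹ : ∀ w v → wreathAct w (wreathAct (w ⁻¹ʷ) v) ≡ v
  wreathAct-⁻¹ ((g₁ , _) , (g₂ , _) , false) (a , x , i) =
    cong₂ _,_ (Inverse.strictlyInverseˡ g₁ a) (cong₂ _,_ (Inverse.strictlyInverseˡ g₂ x) refl)
  wreathAct-⁻¹ ((g₁ , _) , (g₂ , _) , true) (a , x , i) =
    cong₂ _,_ (Inverse.strictlyInverseˡ g₂ a)
              (cong₂ _,_ (Inverse.strictlyInverseˡ g₁ x) (not-involutive i))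

  wreathAct-cong : ∀ {w w′} → w ≈ʷ w′ → ∀ v → wreathAct w v ≡ wreathAct w′ v
  wreathAct-cong {_ , _ , false} (g₁≈h₁ , g₂≈h₂ , refl) (a , x , i) =
    cong₂ _,_ (g₁≈h₁ a) (cong₂ _,_ (g₂≈h₂ x) refl)
  wreathAct-cong {_ , _ , true} (g₁≈h₁ , g₂≈h₂ , refl) (a , x , i) =
    cong₂ _,_ (g₂≈h₂ x) (cong₂ _,_ (g₁≈h₁ a) refl)

  -- The C₂-component is read off the ℤ₂-coordinate, so a single vertex v₀ suffices for it.
  wreathAct-faithful : V → ∀ w w′ → (∀ v → wreathAct w v ≡ wreathAct w′ v) → w ≈ʷ w′
  wreathAct-faithful _ (_ , _ , false) (_ , _ , false) w≗w′ =
    (λ a → cong proj₁ (w≗w′ (a , a , false))) ,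
    (λ x → cong (proj₁ ∘ proj₂) (w≗w′ (x , x , false))) , refl
  wreathAct-faithful _ (_ , _ , true) (_ , _ , true) w≗w′ =
    (λ a → cong (proj₁ ∘ proj₂) (w≗w′ (a , a , false))) ,
    (λ x → cong proj₁ (w≗w′ (x , x , false))) , refl
  wreathAct-faithful v₀ (_ , _ , false) (_ , _ , true) w≗w′
    with () ← cong (proj₂ ∘ proj₂) (w≗w′ (v₀ , v₀ , false))
  wreathAct-faithful v₀ (_ , _ , true) (_ , _ , false) w≗w′
    with () ← cong (proj₂ ∘ proj₂) (w≗w′ (v₀ , v₀ , false))

  private
    GGτ-group : RawGroup _ _
    GGτ-group = GenRawGroup (GGτ G)

  genToWreath : ∀ {p} → Gen (GGτ G) p → W
  genToWreath (gen (inj₁ (g₁ , g₂ , g₁∈ , g₂∈ , _))) = (g₁ , g₁∈) , (g₂ , g₂∈) , false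
  genToWreath (gen (inj₂ _))                         = (idₚ , id∈ G) , (idₚ , id∈ G) , true
  genToWreath idg                                    = εʷ
  genToWreath (mulg gp gq)                           = genToWreath gp ∙ʷ genToWreath gq
  genToWreath (invg gp)                              = genToWreath gp ⁻¹ʷ
  genToWreath (resg _ gp)                            = genToWreath gp

  genToWreath-act : ∀ {p} (gp : Gen (GGτ G) p) v → p ⟨ v ⟩ ≡ wreathAct (genToWreath gp) v
  genToWreath-act (gen (inj₁ (_ , _ , _ , _ , p≈g₁g₂))) v = p≈g₁g₂ v
  genToWreath-act (gen (inj₂ p≈τ))                     v = p≈τ v
  genToWreath-act idg                                  v = refl
  genToWreath-act (mulg {p} {q} gp gq) v = begin
    q ⟨ p ⟨ v ⟩ ⟩
      ≡⟨ genToWreath-act gq _ ⟩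
    wreathAct (genToWreath gq) (p ⟨ v ⟩)
      ≡⟨ cong (wreathAct (genToWreath gq)) (genToWreath-act gp v) ⟩
    wreathAct (genToWreath gq) (wreathAct (genToWreath gp) v)
      ≡⟨ wreathAct-∙ (genToWreath gp) (genToWreath gq) v ⟩
    wreathAct (genToWreath gp ∙ʷ genToWreath gq) v
      ∎
    where open ≡-Reasoning
  genToWreath-act (invg {p} gp) v = begin
    Inverse.from p v                                        ≡⟨ cong (Inverse.from p) (sym p⟨w⁻¹v⟩≡v) ⟩
    Inverse.from p (p ⟨ wreathAct (genToWreath gp ⁻¹ʷ) v ⟩) ≡⟨ Inverse.strictlyInverseʳ p _ ⟩
    wreathAct (genToWreath gp ⁻¹ʷ) v                        ∎
    where
    open ≡-Reasoning
    p⟨w⁻¹v⟩≡v : p ⟨ wreathAct (genToWreath gp ⁻¹ʷ) v ⟩ ≡ v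
    p⟨w⁻¹v⟩≡v = trans (genToWreath-act gp _) (wreathAct-⁻¹ (genToWreath gp) v)
  genToWreath-act (resg p≈q gp) v = trans (sym (p≈q v)) (genToWreath-act gp v)

  toWreath : RawGroup.Carrier GGτ-group → W
  toWreath (_ , gp) = genToWreath gp

  fromWreath : (w : W) → Σ (RawGroup.Carrier GGτ-group) λ x → ∀ v → proj₁ x ⟨ v ⟩ ≡ wreathAct w v
  fromWreath ((g₁ , g₁∈) , (g₂ , g₂∈) , false) =
    (pairPerm g₁ g₂ , pairPerm∈Gen G g₁∈ g₂∈) , λ _ → refl
  fromWreath ((g₁ , g₁∈) , (g₂ , g₂∈) , true) =
    (pairPerm g₁ g₂ · τ , mulg {p = pairPerm g₁ g₂} {q = τ} (pairPerm∈Gen G g₁∈ g₂∈) (τ∈Gen G)) ,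
    λ _ → refl

  open GroupMorphisms GGτ-group (WreathC2 G)

  -- toWreath intertwines the two faithful actions on V × V × ℤ₂; the homomorphism laws hold
  -- definitionally.
  toWreath-isGroupIsomorphism : V → IsGroupIsomorphism toWreath
  toWreath-isGroupIsomorphism v₀ = record
    { isGroupMonomorphism = record
      { isGroupHomomorphism = record
        { isMonoidHomomorphism = record
          { isMagmaHomomorphism = record
            { isRelHomomorphism = record { cong = λ {x} {y} → reflects x y }
            ; homo = λ x y → ≈ʷ-refl (toWreath (RawGroup._∙_ GGτ-group x y)) }
          ; ε-homo = ≈ʷ-refl εʷ }
        ; ⁻¹-homo = λ x → ≈ʷ-refl (toWreath (RawGroup._⁻¹ GGτ-group x)) }
      ; injective = λ {x} {y} → preserves x y }
    ; surjective = λ w → proj₁ (fromWreath w) , λ {x} x≈ →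
        wreathAct-faithful v₀ (toWreath x) w λ v →
          trans (sym (genToWreath-act (proj₂ x) v)) (trans (x≈ v) (proj₂ (fromWreath w) v))
    }
    where
    ≈ʷ-refl : ∀ w → w ≈ʷ w
    ≈ʷ-refl w = (λ _ → refl) , (λ _ → refl) , refl

    reflects : ∀ x y → proj₁ x ≈ₚ proj₁ y → toWreath x ≈ʷ toWreath y
    reflects (p , gp) (q , gq) p≈q = wreathAct-faithful v₀ _ _ λ v →
      trans (sym (genToWreath-act gp v)) (trans (p≈q v) (genToWreath-act gq v))

    preserves : ∀ x y → toWreath x ≈ʷ toWreath y → proj₁ x ≈ₚ proj₁ y
    preserves (p , gp) (q , gq) w≈w′ v =
      trans (genToWreath-act gp v) (trans (wreathAct-cong w≈w′ v) (sym (genToWreath-act gq v)))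

Fin-inhabitant : (n : ℕ) → .{{NonZero n}} → Fin n
Fin-inhabitant (suc _) = Fin.zero

corollary3p4 : (n : ℕ) → .{{_ : NonZero n}} → (Δ : Digraph (Fin n)) →
    NoSourcesNoSinks Δ → (G : SymmetryGroup Δ) → DartTransitive Δ (_∈G_ (group G)) →
      ((∀ p → Gen (GGτ (group G)) p → IsSymmetry (SBP _≟_ _≟_ Δ Δ) p)
        × DartTransitive (SBP _≟_ _≟_ Δ Δ) (Gen (GGτ (group G)))
        × Σ (RawGroup.Carrier (GenRawGroup (GGτ (group G))) → RawGroup.Carrier (WreathC2 (group G)))
            (GroupMorphisms.IsGroupIsomorphism (GenRawGroup (GGτ (group G))) (WreathC2 (group G))))
      × ((σ̃ : Perm (Fin n)) → IsReversal Δ σ̃ →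
          (∀ p → Gen (GGτσ (group G) σ̃) p → IsSymmetry (Underlying (SBP _≟_ _≟_ Δ Δ)) p)
          × DartTransitive (Underlying (SBP _≟_ _≟_ Δ Δ)) (Gen (GGτσ (group G) σ̃)))
corollary3p4 n Δ noSourcesNoSinks G Δ-trans =
  ( Gen-isSymmetry Γ (GGτ (group G)) (λ {p} → GGτ-isSymmetry _≟_ G {p})
  , SBP-dartTransitive _≟_ Δ (group G) Δ-trans V-trans
  , toWreath (group G)
  , toWreath-isGroupIsomorphism (group G) (Fin-inhabitant n) )
  , λ σ̃ σ̃-rev →
      Gen-isSymmetry (Underlying Γ) (GGτσ (group G) σ̃)
        (λ {p} → GGτσ-isUnderlyingSymmetry _≟_ G σ̃ σ̃-rev {p})
    , SBP-underlying-dartTransitive _≟_ Δ (group G) Δ-trans V-trans σ̃ σ̃-rev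
  where
  Γ : Digraph (Fin n × Fin n × Bool)
  Γ = SBP _≟_ _≟_ Δ Δ

  V-trans : VertexTransitive (_∈G_ (group G))
  V-trans = dartTransitive⇒vertexTransitive Δ (proj₂ ∘ noSourcesNoSinks) {_∈G_ (group G)} Δ-trans
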